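{- Let $\mathcal{S}_{\mathrm{lex}}(\vec{x},\vec{y},\vec{a},\vec{d})$ be the set of PB constraints below. Then the constraint $d_n\ge1$ follows from $\mathcal{S}_{\mathrm{lex}}(\vec{x},\vec{x},\vec{a},\vec{d})$ (i.e., $\mathcal{S}_{\mathrm{lex}}$ with each $y_i$ replaced by $x_i$) by a single reverse unit propagation (RUP) step requiring $O(n)$ propagations. (Thus reflexivity of the order defined by $\mathcal{O}=\{d_n\ge1\}$ and $\mathcal{S}_{\mathrm{lex}}$ can be proven in this way.)
   Context: Literals: $x$ or $\bar x=1-x$. For $n\ge1$, variables $x_1..x_n$, $y_1..y_n$, $a_1..a_{n-1}$, $d_1..d_n$, $\mathcal{S}_{\mathrm{lex}}(\vec{x},\vec{y},\vec{a},\vec{d})$ consists of: $\bar a_1+x_1+\bar y_1\ge1$; $2a_1+\bar x_1+y_1\ge2$; for $1\le i\le n-2$: $3\bar a_{i+1}+2a_i+x_{i+1}+\bar y_{i+1}\ge3$ and $2a_{i+1}+2\bar a_i+\bar x_{i+1}+y_{i+1}\ge2$; $\bar d_1+y_1+\bar x_1\ge1$; $2d_1+\bar y_1+x_1\ge2$; for $1\le i\le n-1$: $4\bar d_{i+1}+3d_i+\bar a_i+y_{i+1}+\bar x_{i+1}\ge4$ and $4d_{i+1}+3\bar d_i+a_i+\bar y_{i+1}+x_{i+1}\ge3$. (These encode $a_1\Leftrightarrow x_1\ge y_1$, $a_{i+1}\Leftrightarrow(a_i\wedge x_{i+1}\ge y_{i+1})$, $d_1\Leftrightarrow y_1\ge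 x_1$, $d_{i+1}\Leftrightarrow(d_i\wedge(\bar a_i\vee y_{i+1}\ge x_{i+1}))$.) Reverse unit propagation: for a partial assignment $\rho$ and PB constraint $C\doteq\sum_i a_i\ell_i\ge A$, $\mathrm{slack}(C,\rho)=\sum_{i:\rho(\ell_i)\ne0}a_i-A$; $C$ propagates an unassigned literal $\ell_i$ to 1 if $a_i>\mathrm{slack}(C,\rho)$, and is a conflict if its slack is negative. A formula $F$ implies $C$ by RUP if, starting from the empty assignment, repeatedly applying propagations from $F\cup\{\neg C\}$ (where $\neg C\doteq\sum_i a_i\bar\ell_i\ge\sum_ia_i-A+1$) reaches a conflict; the number of propagations is the number of literals so assigned. -}

module Defs where

open import Data.Nat as ℕ using (ℕ; zero; suc; _≤_)
open import Data.Integer as ℤ using (ℤ; +_; _-_; _<_)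
open import Data.Fin as Fin using (Fin; inject₁; fromℕ)
import Data.Fin.Properties as FinP
open import Data.Bool using (Bool; true; false)
open import Data.Maybe using (Maybe; just; nothing)
open import Data.List using (List; []; _∷_; _++_; map; concatMap; allFin)
open import Data.List.Membership.Propositional using (_∈_)
open import Data.Product using (_×_; _,_; proj₁; proj₂)
open import Relation.Nullary using (yes; no; ¬_)
open import Relation.Binary.PropositionalEquality using (_≡_; refl; _≢_)
open import Relation.Binary.Definitions using (DecidableEquality)
open import Data.Bool using (if_then_else_)

data Lit (V : Set) : Set where
  pos : V → Lit V
  neg : V → Lit V

var : ∀ {V} → Lit V → V
var (pos v) = v
var (neg v) = v

negLit : ∀ {V} → Lit V → Lit V
negLit (pos v) = neg v
negLit (neg v) = pos v

record PB (V : Set) : Set where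
  constructor _≥'_
  field
    terms  : List (ℕ × Lit V)
    degree : ℤ
open PB public
infix 4 _≥'_

coeffSum : ∀ {V} → List (ℕ × Lit V) → ℕ
coeffSum [] = 0
coeffSum ((a , _) ∷ ts) = a ℕ.+ coeffSum ts

negPB : ∀ {V} → PB V → PB V
negPB C = map (λ t → proj₁ t , negLit (proj₂ t)) (terms C)
          ≥' ((+ (coeffSum (terms C)) - degree C) ℤ.+ + 1)

-- Normalisation (used when substituting y_i := x_i): terms over the same
-- variable are merged; a·ℓ + b·ℓ̄ is rewritten as min(a,b) + |a-b|·(ℓ or ℓ̄),
-- the constant min(a,b) being moved to the degree; zero terms are dropped.

module _ {V : Set} (_≟_ : DecidableEquality V) where

  addTerm : ℕ × Lit V → List (ℕ × Lit V) → List (ℕ × Lit V) × ℕ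
  addTerm t [] = (t ∷ [] , 0)
  addTerm (a , ℓ) ((b , ℓ') ∷ ts) with var ℓ ≟ var ℓ'
  ... | no _ = let r = addTerm (a , ℓ) ts in ((b , ℓ') ∷ proj₁ r , proj₂ r)
  addTerm (a , pos v) ((b , pos w) ∷ ts) | yes _ = ((a ℕ.+ b , pos v) ∷ ts , 0)
  addTerm (a , neg v) ((b , neg w) ∷ ts) | yes _ = ((a ℕ.+ b , neg v) ∷ ts , 0)
  addTerm (a , ℓ) ((b , ℓ') ∷ ts) | yes _ =
    if a ℕ.≤ᵇ b then ((b ℕ.∸ a , ℓ') ∷ ts , a) else ((a ℕ.∸ b , ℓ) ∷ ts , b)

  mergeTerms : List (ℕ × Lit V) → List (ℕ × Lit V) × ℕ
  mergeTerms [] = ([] , 0)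
  mergeTerms (t ∷ ts) =
    let r = mergeTerms ts
        s = addTerm t (proj₁ r)
    in (proj₁ s , proj₂ r ℕ.+ proj₂ s)

  dropZero : List (ℕ × Lit V) → List (ℕ × Lit V)
  dropZero [] = []
  dropZero ((zero , ℓ) ∷ ts) = dropZero ts
  dropZero ((suc a , ℓ) ∷ ts) = (suc a , ℓ) ∷ dropZero ts

  normalize : PB V → PB V
  normalize C = let r = mergeTerms (terms C)
                in dropZero (proj₁ r) ≥' (degree C - + (proj₂ r))

Assignment : Set → Set
Assignment V = V → Maybe Bool

emptyAssignment : ∀ {V} → Assignment V
emptyAssignment _ = nothing

litVal : ∀ {V} → Assignment V → Lit V → Maybe Bool
litVal ρ (pos v) = ρ v
litVal ρ (neg v) with ρ v
... | nothing = nothing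
... | just b  = just (Data.Bool.not b)

notFalseSum : ∀ {V} → Assignment V → List (ℕ × Lit V) → ℕ
notFalseSum ρ [] = 0
notFalseSum ρ ((a , ℓ) ∷ ts) with litVal ρ ℓ
... | just false = notFalseSum ρ ts
... | _          = a ℕ.+ notFalseSum ρ ts

slack : ∀ {V} → PB V → Assignment V → ℤ
slack C ρ = + (notFalseSum ρ (terms C)) - degree C

module _ {V : Set} (_≟_ : DecidableEquality V) where

  assignTrue : Assignment V → Lit V → Assignment V
  assignTrue ρ ℓ w with w ≟ var ℓ
  assignTrue ρ (pos v) w | yes _ = just true
  assignTrue ρ (neg v) w | yes _ = just false
  ... | no _ = ρ w

  data ReachesConflict (F : List (PB V)) : Assignment V → ℕ → Set where
    conflict : ∀ {ρ} (C : PB V) → C ∈ F → slack C ρ < + 0 →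
               ReachesConflict F ρ 0
    propagate : ∀ {ρ k} (C : PB V) → C ∈ F →
                (a : ℕ) (ℓ : Lit V) → (a , ℓ) ∈ terms C →
                litVal ρ ℓ ≡ nothing →
                slack C ρ < + a →
                ReachesConflict F (assignTrue ρ ℓ) k →
                ReachesConflict F ρ (suc k)

  RUPWith : List (PB V) → PB V → ℕ → Set
  RUPWith F C k = ReachesConflict (negPB C ∷ F) emptyAssignment k

-- S_lex for n = suc m (so a_1 .. a_{n-1} are indexed by Fin m, and
-- 0-based index i of Fin (suc m) stands for the paper's index i+1).

module _ {V : Set} where

  Slex : (m : ℕ) → (X Y : Fin (suc m) → V) → (A : Fin m → V) →
         (D : Fin (suc m) → V) → List (PB V)
  Slex m X Y A D = aPart m X Y A ++ dPart
    where
    aPart : (m : ℕ) → (X Y : Fin (suc m) → V) → (A : Fin m → V) → List (PB V)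
    aPart zero X Y A = []
    aPart (suc m') X Y A =
      ((1 , neg (A Fin.zero)) ∷ (1 , pos (X Fin.zero)) ∷ (1 , neg (Y Fin.zero)) ∷ [] ≥' + 1)
      ∷ ((2 , pos (A Fin.zero)) ∷ (1 , neg (X Fin.zero)) ∷ (1 , pos (Y Fin.zero)) ∷ [] ≥' + 2)
      -- for 1 ≤ i ≤ n-2 (k = i-1 : Fin m')
      ∷ concatMap (λ k →
          ((3 , neg (A (Fin.suc k))) ∷ (2 , pos (A (inject₁ k)))
            ∷ (1 , pos (X (Fin.suc (inject₁ k)))) ∷ (1 , neg (Y (Fin.suc (inject₁ k)))) ∷ [] ≥' + 3)
          ∷ ((2 , pos (A (Fin.suc k))) ∷ (2 , neg (A (inject₁ k)))
            ∷ (1 , neg (X (Fin.suc (inject₁ k)))) ∷ (1 , pos (Y (Fin.suc (inject₁ k)))) ∷ [] ≥' + 2)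
          ∷ []) (allFin m')
    dPart : List (PB V)
    dPart =
      ((1 , neg (D Fin.zero)) ∷ (1 , pos (Y Fin.zero)) ∷ (1 , neg (X Fin.zero)) ∷ [] ≥' + 1)
      ∷ ((2 , pos (D Fin.zero)) ∷ (1 , neg (Y Fin.zero)) ∷ (1 , pos (X Fin.zero)) ∷ [] ≥' + 2)
      -- for 1 ≤ i ≤ n-1 (k = i-1 : Fin m)
      ∷ concatMap (λ k →
          ((4 , neg (D (Fin.suc k))) ∷ (3 , pos (D (inject₁ k))) ∷ (1 , neg (A k))
            ∷ (1 , pos (Y (Fin.suc k))) ∷ (1 , neg (X (Fin.suc k))) ∷ [] ≥' + 4)
          ∷ ((4 , pos (D (Fin.suc k))) ∷ (3 , neg (D (inject₁ k))) ∷ (1 , pos (A k))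
            ∷ (1 , neg (Y (Fin.suc k))) ∷ (1 , pos (X (Fin.suc k))) ∷ [] ≥' + 3)
          ∷ []) (allFin m)

data LexVar (m : ℕ) : Set where
  xv : Fin (suc m) → LexVar m
  av : Fin m → LexVar m
  dv : Fin (suc m) → LexVar m

_≟LV_ : ∀ {m} → DecidableEquality (LexVar m)
xv i ≟LV xv j with i FinP.≟ j
... | yes refl = yes refl
... | no p = no λ { refl → p refl }
av i ≟LV av j with i FinP.≟ j
... | yes refl = yes refl
... | no p = no λ { refl → p refl }
dv i ≟LV dv j with i FinP.≟ j
... | yes refl = yes refl
... | no p = no λ { refl → p refl }
xv _ ≟LV av _ = no λ ()
xv _ ≟LV dv _ = no λ ()
av _ ≟LV xv _ = no λ ()
av _ ≟LV dv _ = no λ ()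
dv _ ≟LV xv _ = no λ ()
dv _ ≟LV av _ = no λ ()

SlexRefl : (m : ℕ) → List (PB (LexVar m))
SlexRefl m = map (normalize _≟LV_) (Slex m xv xv av dv)

dn≥1 : (m : ℕ) → PB (LexVar m)
dn≥1 m = (1 , pos (dv (fromℕ m))) ∷ [] ≥' + 1

module Submission where

open import Defs
open import Data.Nat using (ℕ; suc; _*_; _≤_)
open import Data.Product using (Σ; _×_; ∃)

open import Data.Nat using (zero; _+_; _<_; _<?_; z≤n; s≤s)
open import Data.Nat.Properties
  using (≤-refl; ≤-reflexive; ≤-pred; <⇒≱; ≤∧≢⇒<; m<n⇒m<1+n; n≤1+n; 1+n≢n; +-monoʳ-≤)
open import Data.Integer as ℤ using (ℤ; +_; _-_)
open import Data.Fin as Fin using (Fin; toℕ; inject₁; fromℕ)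
open import Data.Fin.Properties 
  using (toℕ-injective; toℕ-inject₁; toℕ<n; inject₁ℕ<; fromℕ≢inject₁; suc-injective)
open import Data.Bool using (Bool; true; false; not)
open import Data.Maybe using (Maybe; just; nothing)
open import Data.List using (List; []; _∷_)
open import Data.List.Membership.Propositional using (_∈_)
open import Data.List.Membership.Propositional.Properties 
  using (∈-map⁺; ∈-++⁺ˡ; ∈-++⁺ʳ; ∈-concatMap⁺; ∈-allFin)
open import Data.List.Relation.Unary.Any using (here; there)
import Data.List.Relation.Unary.Any as Any
open import Data.Product using (_,_)
open import Function using (_∘_)
open import Relation.Nullary using (yes; no; contradiction)
open import Relation.Nullary.Decidable using (True; toWitness)
open import Relation.Binary.PropositionalEquality using (_≡_; _≢_; refl; sym; trans; cong; subst; _≗_)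
open import Relation.Binary.Definitions using (DecidableEquality)

-- With y⃗ := x⃗ the terms x_i and x̄_i of a constraint cancel to a constant, and
-- the constraints that drive the propagation normalise to plain implications:
-- 2a₁ ≥ 1, 2ā_i + 2a_{i+1} ≥ 1, 2d₁ ≥ 1 and a_i + 3d̄_i + 4d_{i+1} ≥ 2.
-- Negating d_n ≥ 1 sets d_n to 0; unit propagation then sets a₁, …, a_{n-1}
-- and d₁, …, d_{n-1} to 1 one after the other, and the last d-constraint,
-- with a_{n-1} = d_{n-1} = 1 and d_n = 0, has slack -1.  That is 2n - 1
-- propagations.

module UnitPropagation {V : Set} (_≟_ : DecidableEquality V) where

  litVal-cong : ∀ {ρ σ : Assignment V} → ρ ≗ σ → ∀ ℓ → litVal ρ ℓ ≡ litVal σ ℓ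
  litVal-cong ρ≗σ (pos v) = ρ≗σ v
  litVal-cong {ρ} {σ} ρ≗σ (neg v) with ρ v | σ v | ρ≗σ v
  ... | nothing | .nothing | refl = refl
  ... | just b  | .(just b) | refl = refl

  notFalseSum-cong : ∀ {ρ σ : Assignment V} → ρ ≗ σ → ∀ ts → notFalseSum ρ ts ≡ notFalseSum σ ts
  notFalseSum-cong ρ≗σ [] = refl
  notFalseSum-cong {ρ} {σ} ρ≗σ ((a , ℓ) ∷ ts)
    with litVal ρ ℓ | litVal σ ℓ | litVal-cong ρ≗σ ℓ
  ... | nothing    | .nothing      | refl = cong (λ n → a + n) (notFalseSum-cong ρ≗σ ts)
  ... | just true  | .(just true)  | refl = cong (λ n → a + n) (notFalseSum-cong ρ≗σ ts)
  ... | just false | .(just false) | refl = notFalseSum-cong ρ≗σ ts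

  slack-cong : ∀ {ρ σ : Assignment V} → ρ ≗ σ → ∀ C → slack C ρ ≡ slack C σ
  slack-cong ρ≗σ C = cong (λ n → + n - degree C) (notFalseSum-cong ρ≗σ (terms C))

  assignTrue-cong : ∀ {ρ σ : Assignment V} → ρ ≗ σ → ∀ ℓ → assignTrue _≟_ ρ ℓ ≗ assignTrue _≟_ σ ℓ
  assignTrue-cong ρ≗σ (pos v) w with w ≟ v
  ... | yes _ = refl
  ... | no _  = ρ≗σ w
  assignTrue-cong ρ≗σ (neg v) w with w ≟ v
  ... | yes _ = refl
  ... | no _  = ρ≗σ w

  ReachesConflict-resp-≗ : ∀ {F ρ σ k} → ρ ≗ σ → ReachesConflict _≟_ F ρ k → ReachesConflict _≟_ F σ k
  ReachesConflict-resp-≗ ρ≗σ (conflict C C∈F s<0) =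
    conflict C C∈F (subst (ℤ._< + 0) (slack-cong ρ≗σ C) s<0)
  ReachesConflict-resp-≗ ρ≗σ (propagate C C∈F a ℓ aℓ∈C unset s<a rest) =
    propagate C C∈F a ℓ aℓ∈C (trans (sym (litVal-cong ρ≗σ ℓ)) unset)
      (subst (ℤ._< + a) (slack-cong ρ≗σ C) s<a)
      (ReachesConflict-resp-≗ (assignTrue-cong ρ≗σ ℓ) rest)

  -- The slack is given through the value n of notFalseSum, which turns the
  -- propagation condition into closed integer arithmetic.
  data Propagates (F : List (PB V)) (ρ σ : Assignment V) : Set where
    propagates : ∀ {C a ℓ n} → C ∈ F → (a , ℓ) ∈ terms C → litVal ρ ℓ ≡ nothing →
                 notFalseSum ρ (terms C) ≡ n → + n - degree C ℤ.< + a →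
                 assignTrue _≟_ ρ ℓ ≗ σ → Propagates F ρ σ

  propagate-then : ∀ {F ρ σ k} → Propagates F ρ σ →
                   ReachesConflict _≟_ F σ k → ReachesConflict _≟_ F ρ (suc k)
  propagate-then (propagates {C} {a} {ℓ} C∈F aℓ∈C unset refl s<a ρ′≗σ) rest =
    propagate C C∈F a ℓ aℓ∈C unset s<a (ReachesConflict-resp-≗ (sym ∘ ρ′≗σ) rest)

  conflict-by : ∀ {F ρ C n} → C ∈ F → notFalseSum ρ (terms C) ≡ n → + n - degree C ℤ.< + 0 →
                ReachesConflict _≟_ F ρ 0
  conflict-by {C = C} C∈F refl s<0 = conflict C C∈F s<0

  propagate-chain : ∀ {F k} n (ρ : ℕ → Assignment V) →
                    ((i : Fin n) → Propagates F (ρ (toℕ i)) (ρ (suc (toℕ i)))) →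
                    ReachesConflict _≟_ F (ρ n) k → ReachesConflict _≟_ F (ρ 0) (n + k)
  propagate-chain zero    ρ steps rest = rest
  propagate-chain (suc n) ρ steps rest =
    propagate-then (steps Fin.zero) (propagate-chain n (ρ ∘ suc) (steps ∘ Fin.suc) rest)

  weightUnlessFalse : Maybe Bool → ℕ → ℕ
  weightUnlessFalse (just false) a = 0
  weightUnlessFalse _            a = a

  notFalseSum-∷ : ∀ (ρ : Assignment V) ℓ {a ts v n} → litVal ρ ℓ ≡ v → notFalseSum ρ ts ≡ n →
                  notFalseSum ρ ((a , ℓ) ∷ ts) ≡ weightUnlessFalse v a + n
  notFalseSum-∷ ρ ℓ ℓ≡v refl with litVal ρ ℓ
  notFalseSum-∷ ρ ℓ refl refl | nothing    = refl
  notFalseSum-∷ ρ ℓ refl refl | just true  = refl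
  notFalseSum-∷ ρ ℓ refl refl | just false = refl

  litVal-neg : ∀ (ρ : Assignment V) v {b} → ρ v ≡ just b → litVal ρ (neg v) ≡ just (not b)
  litVal-neg ρ v ρv≡b with ρ v
  litVal-neg ρ v refl | just b = refl

  assignTrue-≗ : ∀ {ρ σ : Assignment V} {ℓ} → litVal σ ℓ ≡ just true →
                 (∀ w → w ≢ var ℓ → ρ w ≡ σ w) → assignTrue _≟_ ρ ℓ ≗ σ
  assignTrue-≗ {ℓ = pos v} σv unchanged w with w ≟ v
  ... | yes refl = sym σv
  ... | no w≢v   = unchanged w w≢v
  assignTrue-≗ {σ = σ} {neg v} σv̄ unchanged w with w ≟ v
  ... | no w≢v   = unchanged w w≢v
  ... | yes refl with σ v | σv̄
  ...   | just false | refl = refl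

by-decision : ∀ {x y : ℤ} {t : True (x ℤ.<? y)} → x ℤ.< y
by-decision {t = t} = toWitness t

trueBelow : ℕ → ℕ → Maybe Bool
trueBelow j i with i <? j
... | yes _ = just true
... | no _  = nothing

trueBelow-< : ∀ {i j} → i < j → trueBelow j i ≡ just true
trueBelow-< {i} {j} i<j with i <? j
... | yes _   = refl
... | no i≮j = contradiction i<j i≮j

trueBelow-≥ : ∀ {i j} → j ≤ i → trueBelow j i ≡ nothing
trueBelow-≥ {i} {j} j≤i with i <? j
... | yes i<j = contradiction j≤i (<⇒≱ i<j)
... | no _    = refl

trueBelow-suc : ∀ {i j} → i ≢ j → trueBelow (suc j) i ≡ trueBelow j i
trueBelow-suc {i} {j} i≢j with i <? suc j | i <? j
... | yes _     | yes _   = refl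
... | no _      | no _    = refl
... | yes i<1+j | no i≮j = contradiction (≤∧≢⇒< (≤-pred i<1+j) i≢j) i≮j
... | no i≮1+j  | yes i<j = contradiction (m<n⇒m<1+n i<j) i≮1+j

rupInput : (m : ℕ) → List (PB (LexVar m))
rupInput m = negPB (dn≥1 m) ∷ SlexRefl m

normalized∈ : ∀ {m C N} → C ∈ Slex m xv xv av dv → normalize _≟LV_ C ≡ N → N ∈ rupInput m
normalized∈ C∈ refl = there (∈-map⁺ (normalize _≟LV_) C∈)

suc≢inject₁ : ∀ {n} (k : Fin n) → Fin.suc k ≢ inject₁ k
suc≢inject₁ k eq = 1+n≢n (trans (cong toℕ eq) (toℕ-inject₁ k))

aFirst∈ : ∀ {m} → ((2 , pos (av Fin.zero)) ∷ [] ≥' + 1) ∈ rupInput (suc m)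
aFirst∈ = normalized∈ (there (here refl)) refl

aNext∈ : ∀ {m} (k : Fin m) →
         ((2 , neg (av (inject₁ k))) ∷ (2 , pos (av (Fin.suc k))) ∷ [] ≥' + 1) ∈ rupInput (suc m)
aNext∈ k = normalized∈ (there (there (∈-++⁺ˡ
  (∈-concatMap⁺ _ (Any.map (λ { refl → there (here refl) }) (∈-allFin k)))))) merge
  where
  merge : normalize _≟LV_
            ((2 , pos (av (Fin.suc k))) ∷ (2 , neg (av (inject₁ k)))
              ∷ (1 , neg (xv (Fin.suc (inject₁ k)))) ∷ (1 , pos (xv (Fin.suc (inject₁ k)))) ∷ [] ≥' + 2)
          ≡ ((2 , neg (av (inject₁ k))) ∷ (2 , pos (av (Fin.suc k))) ∷ [] ≥' + 1)
  merge with inject₁ k Fin.≟ inject₁ k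
  ... | no k≢k = contradiction refl k≢k
  ... | yes refl with Fin.suc k Fin.≟ inject₁ k
  ...   | yes eq = contradiction eq (suc≢inject₁ k)
  ...   | no _   = refl

dFirst∈ : ∀ {m} → ((2 , pos (dv Fin.zero)) ∷ [] ≥' + 1) ∈ rupInput m
dFirst∈ = normalized∈ (∈-++⁺ʳ _ (there (here refl))) refl

dNext∈ : ∀ {m} (k : Fin m) →
         ((1 , pos (av k)) ∷ (3 , neg (dv (inject₁ k))) ∷ (4 , pos (dv (Fin.suc k))) ∷ [] ≥' + 2) ∈ rupInput m
dNext∈ k = normalized∈ (∈-++⁺ʳ _ (there (there
  (∈-concatMap⁺ _ (Any.map (λ { refl → there (here refl) }) (∈-allFin k)))))) merge
  where
  merge : normalize _≟LV_
            ((4 , pos (dv (Fin.suc k))) ∷ (3 , neg (dv (inject₁ k))) ∷ (1 , pos (av k))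
              ∷ (1 , neg (xv (Fin.suc k))) ∷ (1 , pos (xv (Fin.suc k))) ∷ [] ≥' + 3)
          ≡ ((1 , pos (av k)) ∷ (3 , neg (dv (inject₁ k))) ∷ (4 , pos (dv (Fin.suc k))) ∷ [] ≥' + 2)
  merge with k Fin.≟ k
  ... | no k≢k = contradiction refl k≢k
  ... | yes refl with Fin.suc k Fin.≟ inject₁ k
  ...   | yes eq = contradiction eq (suc≢inject₁ k)
  ...   | no _   = refl

open module LexPropagation {m} = UnitPropagation (_≟LV_ {m})

module _ {m : ℕ} where

  -- The assignment after propagating d_n := 0, the first ja of the a's and
  -- the first jd of the d's.
  state : ℕ → ℕ → Assignment (LexVar m)
  state ja jd (xv _) = nothing
  state ja jd (av i) = trueBelow ja (toℕ i)
  state ja jd (dv i) with i Fin.≟ fromℕ m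
  ... | yes _ = just false
  ... | no _  = trueBelow jd (toℕ i)

  state-dₙ : ∀ {ja jd} → state ja jd (dv (fromℕ m)) ≡ just false
  state-dₙ with fromℕ m Fin.≟ fromℕ m
  ... | yes _  = refl
  ... | no n≢n = contradiction refl n≢n

  state-d : ∀ {ja jd i} → i ≢ fromℕ m → state ja jd (dv i) ≡ trueBelow jd (toℕ i)
  state-d {i = i} i≢n with i Fin.≟ fromℕ m
  ... | yes i≡n = contradiction i≡n i≢n
  ... | no _    = refl

  state-d-suc : ∀ {ja jd} i → toℕ i ≢ jd → state ja jd (dv i) ≡ state ja (suc jd) (dv i)
  state-d-suc i i≢jd with i Fin.≟ fromℕ m
  ... | yes _ = refl
  ... | no _  = sym (trueBelow-suc i≢jd)

  assign-a : ∀ {jd} (i : Fin m) → assignTrue _≟LV_ (state (toℕ i) jd) (pos (av i)) ≗ state (suc (toℕ i)) jd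
  assign-a {jd} i = assignTrue-≗ {ℓ = pos (av i)} (trueBelow-< ≤-refl) unchanged
    where
    unchanged : ∀ w → w ≢ av i → state (toℕ i) jd w ≡ state (suc (toℕ i)) jd w
    unchanged (xv _) _    = refl
    unchanged (av j) j≢i  = sym (trueBelow-suc (j≢i ∘ cong av ∘ toℕ-injective))
    unchanged (dv _) _    = refl

  assign-d : ∀ {ja jd} (i : Fin (suc m)) → toℕ i ≡ jd → i ≢ fromℕ m →
             assignTrue _≟LV_ (state ja jd) (pos (dv i)) ≗ state ja (suc jd)
  assign-d {ja} i refl i≢n = assignTrue-≗ {ℓ = pos (dv i)} (trans (state-d {ja} i≢n) (trueBelow-< ≤-refl)) unchanged
    where
    unchanged : ∀ w → w ≢ dv i → state ja (toℕ i) w ≡ state ja (suc (toℕ i)) w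
    unchanged (xv _) _   = refl
    unchanged (av _) _   = refl
    unchanged (dv j) j≢i = state-d-suc {ja} j (j≢i ∘ cong dv ∘ toℕ-injective)

negGoal-step : ∀ {m} → Propagates (rupInput m) emptyAssignment (state 0 0)
negGoal-step {m} = propagates (here refl) (here refl) refl refl by-decision
  (assignTrue-≗ {ℓ = neg (dv (fromℕ m))} (litVal-neg (state 0 0) (dv (fromℕ m)) (state-dₙ {m} {0} {0})) unchanged)
  where
  unchanged : ∀ w → w ≢ dv (fromℕ m) → emptyAssignment w ≡ state 0 0 w
  unchanged (xv _) _   = refl
  unchanged (av i) _   = sym (trueBelow-≥ {toℕ i} z≤n)
  unchanged (dv i) i≢n = sym (trans (state-d {m} {0} {0} (i≢n ∘ cong dv)) (trueBelow-≥ {toℕ i} z≤n))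

a-step : ∀ {m} (i : Fin m) → Propagates (rupInput m) (state (toℕ i) 0) (state (suc (toℕ i)) 0)
a-step Fin.zero    = propagates aFirst∈ (here refl) refl refl by-decision (assign-a Fin.zero)
a-step (Fin.suc k) = propagates (aNext∈ k) (there (here refl)) aₖ₊₁-unset
  (notFalseSum-∷ ρ (neg (av (inject₁ k))) (litVal-neg ρ (av (inject₁ k)) (trueBelow-< (s≤s (≤-reflexive (toℕ-inject₁ k)))))
    (notFalseSum-∷ ρ (pos (av (Fin.suc k))) aₖ₊₁-unset refl))
  by-decision
  (assign-a (Fin.suc k))
  where
  ρ = state (suc (toℕ k)) 0
  aₖ₊₁-unset : state (suc (toℕ k)) 0 (av (Fin.suc k)) ≡ nothing
  aₖ₊₁-unset = trueBelow-≥ ≤-refl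

d-step : ∀ {m} (i : Fin m) → Propagates (rupInput m) (state m (toℕ i)) (state m (suc (toℕ i)))
d-step Fin.zero = propagates dFirst∈ (here refl) refl refl by-decision (assign-d Fin.zero refl λ ())
d-step {suc m} (Fin.suc k) = propagates (dNext∈ (inject₁ k)) (there (there (here refl))) dₖ₊₁-unset
  (notFalseSum-∷ ρ (pos (av (inject₁ k))) (trueBelow-< (toℕ<n (inject₁ k)))
    (notFalseSum-∷ ρ (neg (dv (inject₁ (inject₁ k)))) (litVal-neg ρ (dv (inject₁ (inject₁ k))) dₖ-set)
      (notFalseSum-∷ ρ (pos (dv (Fin.suc (inject₁ k)))) dₖ₊₁-unset refl)))
  by-decision
  (assign-d (Fin.suc (inject₁ k)) (cong suc (toℕ-inject₁ k)) k+1≢n)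
  where
  ρ : Assignment (LexVar (suc m))
  ρ = state (suc m) (suc (toℕ k))
  k+1≢n : Fin.suc (inject₁ k) ≢ fromℕ (suc m)
  k+1≢n = fromℕ≢inject₁ ∘ sym ∘ suc-injective
  dₖ-set : ρ (dv (inject₁ (inject₁ k))) ≡ just true
  dₖ-set = trans (state-d {suc m} {suc m} (fromℕ≢inject₁ ∘ sym))
                 (trueBelow-< (s≤s (≤-reflexive (trans (toℕ-inject₁ (inject₁ k)) (toℕ-inject₁ k)))))
  dₖ₊₁-unset : ρ (dv (Fin.suc (inject₁ k))) ≡ nothing
  dₖ₊₁-unset = trans (state-d {suc m} {suc m} k+1≢n) (trueBelow-≥ (s≤s (≤-reflexive (sym (toℕ-inject₁ k)))))

d-conflict : ∀ m → ReachesConflict _≟LV_ (rupInput m) (state m m) 0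
d-conflict zero    = conflict-by dFirst∈ refl by-decision
d-conflict (suc m) = conflict-by (dNext∈ (fromℕ m))
  (notFalseSum-∷ ρ (pos (av (fromℕ m))) (trueBelow-< (toℕ<n (fromℕ m)))
    (notFalseSum-∷ ρ (neg (dv (inject₁ (fromℕ m)))) (litVal-neg ρ (dv (inject₁ (fromℕ m))) dₙ₋₁-set)
      (notFalseSum-∷ ρ (pos (dv (fromℕ (suc m)))) (state-dₙ {suc m} {suc m} {suc m}) refl)))
  by-decision
  where
  ρ : Assignment (LexVar (suc m))
  ρ = state (suc m) (suc m)
  dₙ₋₁-set : ρ (dv (inject₁ (fromℕ m))) ≡ just true
  dₙ₋₁-set = trans (state-d {suc m} {suc m} (fromℕ≢inject₁ ∘ sym)) (trueBelow-< (inject₁ℕ< (fromℕ m)))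

lemma13 : Σ ℕ λ c → (m : ℕ) → Σ ℕ λ k →
    (k ≤ c * suc m) × RUPWith _≟LV_ (SlexRefl m) (dn≥1 m) k
lemma13 = 2 , λ m → suc (m + (m + 0)) , s≤s (+-monoʳ-≤ m (n≤1+n (m + 0))) ,
  propagate-then negGoal-step
    (propagate-chain m (λ j → state j 0) a-step
      (propagate-chain m (state m) d-step (d-conflict m)))
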